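{- For $n\ge1$ let $Q_n(x,z)=\sum_{\sigma\in\mathcal{S}_n}x^{\overrightarrow{des}_O(\sigma)}z^{\chi(\sigma_1\text{ odd})}$. Then $Q_1(x,z)=z$, $Q_2(x,z)=z+x$, and for all $n\ge1$, $$Q_{2n+1}(x,z)=x(1-x)\frac{\partial}{\partial x}Q_{2n}(x,z)+z(1-z)\frac{\partial}{\partial z}Q_{2n}(x,z)+(z+n(1+x))Q_{2n}(x,z),$$ $$Q_{2n+2}(x,z)=x(1-x)\frac{\partial}{\partial x}Q_{2n+1}(x,z)+x(1-z)\frac{\partial}{\partial z}Q_{2n+1}(x,z)+(1+n)(1+x)Q_{2n+1}(x,z).$$
   Context: $\mathcal{S}_n$ denotes the set of permutations $\sigma=\sigma_1\cdots\sigma_n$ of $\{1,\dots,n\}$. $\overrightarrow{des}_O(\sigma)$ is the number of indices $i\in\{1,\dots,n-1\}$ with $\sigma_i>\sigma_{i+1}$ and $\sigma_{i+1}$ odd. $\chi(\sigma_1\text{ odd})$ is $1$ if $\sigma_1$ is odd and $0$ otherwise. -}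

module Defs where

open import Data.Nat as ℕ using (ℕ; zero; suc; _<ᵇ_; _≟_)
open import Data.Bool using (Bool; true; false; if_then_else_)
open import Data.Integer as ℤ using (ℤ; +_)
open import Data.List using (List; []; _∷_; map; concatMap; length; filter; upTo)
open import Data.List.Relation.Unary.Unique.Propositional using (Unique)
open import Data.List.Relation.Unary.AllPairs using (allPairs?)
open import Relation.Nullary.Decidable using (¬?)

-- Permutations of {1,…,n} in one-line notation σ₁⋯σₙ :
-- the words of length n over {1,…,n} whose entries are pairwise distinct.

words : ℕ → ℕ → List (List ℕ)
words n zero    = [] ∷ []
words n (suc k) = concatMap (λ a → map (a ∷_) (words n k)) (map suc (upTo n))

Perms : ℕ → List (List ℕ)
Perms n = filter (allPairs? (λ x y → ¬? (x ≟ y))) (words n n)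

isOdd : ℕ → Bool
isOdd zero          = false
isOdd (suc zero)    = true
isOdd (suc (suc m)) = isOdd m

desO : List ℕ → ℕ
desO []           = 0
desO (a ∷ [])     = 0
desO (a ∷ b ∷ w)  = (if (b <ᵇ a) then (if isOdd b then 1 else 0) else 0) ℕ.+ desO (b ∷ w)

chiFirstOdd : List ℕ → ℕ
chiFirstOdd []      = 0
chiFirstOdd (a ∷ w) = if isOdd a then 1 else 0

-- Polynomials in x,z with integer coefficients, represented by their
-- coefficient function: p i j = coefficient of xⁱ zʲ.

Poly : Set
Poly = ℕ → ℕ → ℤ

sumTo : ℕ → (ℕ → ℤ) → ℤ
sumTo zero    f = f zero
sumTo (suc n) f = sumTo n f ℤ.+ f (suc n)

infixl 6 _⊕_ _⊖_
infixl 7 _⊛_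

_⊕_ : Poly → Poly → Poly
(p ⊕ q) i j = p i j ℤ.+ q i j

_⊖_ : Poly → Poly → Poly
(p ⊖ q) i j = p i j ℤ.- q i j

_⊛_ : Poly → Poly → Poly
(p ⊛ q) i j = sumTo i (λ a → sumTo j (λ b → p a b ℤ.* q (i ℕ.∸ a) (j ℕ.∸ b)))

const : ℤ → Poly
const c zero zero = c
const c _    _    = + 0

X : Poly
X (suc zero) zero = + 1
X _          _    = + 0

Z : Poly
Z zero (suc zero) = + 1
Z _    _          = + 0

∂x : Poly → Poly
∂x p i j = + (suc i) ℤ.* p (suc i) j

∂z : Poly → Poly
∂z p i j = + (suc j) ℤ.* p i (suc j)

Q : ℕ → Poly
Q n i j = + length (filter (λ σ → desO σ ≟ i) (filter (λ σ → chiFirstOdd σ ≟ j) (Perms n)))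

module Submission where

-- Every permutation of [m+1] arises exactly once by inserting m+1 into a
-- permutation σ = a w of [m].  Inserted in front, it contributes the monomial
-- z^[m+1 odd] x^(χ(a odd) + desO σ).  Inserted in any of the other m slots it
-- keeps the first letter and every odd descent, and creates a new one exactly
-- when it lands directly before an odd letter that is not a descent bottom;
-- there are (number of odd letters of w) − desO σ such slots.  Summing over σ
-- expresses the coefficients of Q (m+1) through those of Q m and the numbers of
-- even and odd letters in [m].  As Q m has degree at most one in z, comparing
-- coefficients with those of the differential operators gives both recurrences.

open import Defs
open import Data.Bool using (Bool; true; false; if_then_else_)
open import Data.Empty using (⊥-elim)
open import Data.Integer using (ℤ; +_)
import Data.Integer.Properties as ℤ
open import Data.Integer.Tactic.RingSolver using (solve-∀)
open import Data.List using (List; []; _∷_; _++_; map; filter; length; concatMap)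
open import Data.List.Membership.Propositional using (_∈_)
open import Data.List.Relation.Binary.Permutation.Propositional using (_↭_; ↭-sym; ↭⇒↭ₛ)
import Data.List.Relation.Binary.Permutation.Propositional.Properties as ↭
open import Data.List.Relation.Unary.All as All using (All; []; _∷_)
open import Data.List.Relation.Unary.Any using (here; there)
open import Data.Nat as ℕ using (ℕ; zero; suc; _≤_; _<_; z≤n; s≤s; _≟_)
import Data.Nat.Properties as ℕ
open import Data.Product using (_×_; _,_)
open import Function using (_∘_)
open import Relation.Binary.PropositionalEquality
open import Relation.Nullary using (¬_)
open import Relation.Unary using (Pred; Decidable)

module Sums where

  open import Data.Integer using (_+_; _*_)
  open import Data.List using (foldr)
  open import Data.List.Relation.Binary.Permutation.Setoid.Properties using (foldr-commMonoid)
  open import Relation.Nullary using (Dec; does)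

  private
    variable
      A B : Set

  sumBy : (A → ℤ) → List A → ℤ
  sumBy f xs = foldr _+_ (+ 0) (map f xs)

  iverson : ∀ {P : Set} → Dec P → ℤ
  iverson P? = if does P? then + 1 else + 0

  sumBy-cong : ∀ {f g : A → ℤ} xs → (∀ {x} → x ∈ xs → f x ≡ g x) → sumBy f xs ≡ sumBy g xs
  sumBy-cong []       f≗g = refl
  sumBy-cong (x ∷ xs) f≗g = cong₂ _+_ (f≗g (here refl)) (sumBy-cong xs (f≗g ∘ there))

  sumBy-zero : ∀ (xs : List A) → sumBy (λ _ → + 0) xs ≡ + 0
  sumBy-zero []       = refl
  sumBy-zero (x ∷ xs) = trans (ℤ.+-identityˡ _) (sumBy-zero xs)

  sumBy-+ : ∀ (f g : A → ℤ) xs → sumBy (λ x → f x + g x) xs ≡ sumBy f xs + sumBy g xs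
  sumBy-+ f g []       = refl
  sumBy-+ f g (x ∷ xs) = trans (cong (_+_ (f x + g x)) (sumBy-+ f g xs)) (middle-swap (f x) (g x) _ _)
    where
    middle-swap : ∀ a b c d → a + b + (c + d) ≡ a + c + (b + d)
    middle-swap = solve-∀

  sumBy-scale : ∀ c (f : A → ℤ) xs → sumBy (λ x → c * f x) xs ≡ c * sumBy f xs
  sumBy-scale c f []       = sym (ℤ.*-zeroʳ c)
  sumBy-scale c f (x ∷ xs) =
    trans (cong (_+_ (c * f x)) (sumBy-scale c f xs)) (sym (ℤ.*-distribˡ-+ c (f x) (sumBy f xs)))

  sumBy-++ : ∀ (f : A → ℤ) xs ys → sumBy f (xs ++ ys) ≡ sumBy f xs + sumBy f ys
  sumBy-++ f []       ys = sym (ℤ.+-identityˡ _)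
  sumBy-++ f (x ∷ xs) ys = trans (cong (_+_ (f x)) (sumBy-++ f xs ys)) (sym (ℤ.+-assoc (f x) _ _))

  sumBy-concatMap : ∀ (f : B → ℤ) (g : A → List B) xs →
                    sumBy f (concatMap g xs) ≡ sumBy (sumBy f ∘ g) xs
  sumBy-concatMap f g []       = refl
  sumBy-concatMap f g (x ∷ xs) =
    trans (sumBy-++ f (g x) (concatMap g xs)) (cong (_+_ (sumBy f (g x))) (sumBy-concatMap f g xs))

  sumBy-map : ∀ (f : B → ℤ) (g : A → B) xs → sumBy f (map g xs) ≡ sumBy (f ∘ g) xs
  sumBy-map f g []       = refl
  sumBy-map f g (x ∷ xs) = cong (_+_ (f (g x))) (sumBy-map f g xs)

  sumBy-↭ : ∀ (f : A → ℤ) {xs ys} → xs ↭ ys → sumBy f xs ≡ sumBy f ys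
  sumBy-↭ f p = foldr-commMonoid (setoid ℤ) ℤ.+-0-isCommutativeMonoid (↭⇒↭ₛ (↭.map⁺ f p))

  sumBy-filter : ∀ {P : Pred A _} (P? : Decidable P) (f : A → ℤ) xs →
                 sumBy f (filter P? xs) ≡ sumBy (λ x → iverson (P? x) * f x) xs
  sumBy-filter P? f []       = refl
  sumBy-filter P? f (x ∷ xs) with does (P? x)
  ... | true  = cong₂ _+_ (sym (ℤ.*-identityˡ (f x))) (sumBy-filter P? f xs)
  ... | false = trans (sumBy-filter P? f xs) (sym (ℤ.+-identityˡ _))

  length-filter : ∀ {P : Pred A _} (P? : Decidable P) xs →
                  + length (filter P? xs) ≡ sumBy (iverson ∘ P?) xs
  length-filter P? []       = refl
  length-filter P? (x ∷ xs) with does (P? x)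
  ... | true  = cong (_+_ (+ 1)) (length-filter P? xs)
  ... | false = trans (length-filter P? xs) (sym (ℤ.+-identityˡ _))

module Coefficients where

  open import Data.Integer using (_+_; _*_; _-_)
  open import Data.Nat using (_∸_)

  shift : (ℕ → ℤ) → ℕ → ℤ
  shift f zero    = + 0
  shift f (suc k) = f k

  xShift zShift : Poly → Poly
  xShift p i j = shift (λ k → p k j) i
  zShift p i j = shift (p i) j

  θx θz : Poly → Poly
  θx p i j = + i * p i j
  θz p i j = + j * p i j

  shift-cong : ∀ {f g : ℕ → ℤ} i → (∀ k → f k ≡ g k) → shift f i ≡ shift g i
  shift-cong zero    f≗g = refl
  shift-cong (suc k) f≗g = f≗g k

  shift-zero : ∀ {f : ℕ → ℤ} i → (∀ k → f k ≡ + 0) → shift f i ≡ + 0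
  shift-zero zero    f≗0 = refl
  shift-zero (suc k) f≗0 = f≗0 k

  shift-linear : ∀ c d (f g : ℕ → ℤ) i →
                 shift (λ k → c * f k - d * g k) i ≡ c * shift f i - d * shift g i
  shift-linear c d f g zero    = zero-linear c d
    where
    zero-linear : ∀ c d → + 0 ≡ c * + 0 - d * + 0
    zero-linear = solve-∀
  shift-linear c d f g (suc k) = refl

  shift-descending : ∀ c (f : ℕ → ℤ) i →
                     shift (λ k → (c - + k) * f k) i ≡ c * shift f i - shift (λ k → + k * f k) i
  shift-descending c f zero    = zero-scaled c
    where
    zero-scaled : ∀ c → + 0 ≡ c * + 0 - + 0
    zero-scaled = solve-∀
  shift-descending c f (suc k) = distrib c (+ k) (f k)
    where
    distrib : ∀ c x y → (c - x) * y ≡ c * y - x * y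
    distrib = solve-∀

  xShift-∂x : ∀ r i j → xShift (∂x r) i j ≡ θx r i j
  xShift-∂x r zero    j = refl
  xShift-∂x r (suc i) j = refl

  zShift-∂z : ∀ r i j → zShift (∂z r) i j ≡ θz r i j
  zShift-∂z r i zero    = refl
  zShift-∂z r i (suc j) = refl

  sumTo-cong : ∀ n {f g : ℕ → ℤ} → (∀ k → f k ≡ g k) → sumTo n f ≡ sumTo n g
  sumTo-cong zero    f≗g = f≗g zero
  sumTo-cong (suc n) f≗g = cong₂ _+_ (sumTo-cong n f≗g) (f≗g (suc n))

  sumTo-zero : ∀ n {f : ℕ → ℤ} → (∀ k → f k ≡ + 0) → sumTo n f ≡ + 0
  sumTo-zero zero    f≗0 = f≗0 zero
  sumTo-zero (suc n) f≗0 = cong₂ _+_ (sumTo-zero n f≗0) (f≗0 (suc n))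

  sumTo-suc : ∀ n (f : ℕ → ℤ) → sumTo (suc n) f ≡ f 0 + sumTo n (f ∘ suc)
  sumTo-suc zero    f = refl
  sumTo-suc (suc n) f = trans (cong (_+ f (suc (suc n))) (sumTo-suc n f)) (ℤ.+-assoc (f 0) _ _)

  sumTo-head : ∀ n {f : ℕ → ℤ} → (∀ k → f (suc k) ≡ + 0) → sumTo n f ≡ f 0
  sumTo-head zero    f≗0 = refl
  sumTo-head (suc n) {f} f≗0 =
    trans (sumTo-suc n f) (trans (cong (_+_ (f 0)) (sumTo-zero n f≗0)) (ℤ.+-identityʳ (f 0)))

  sumTo-+ : ∀ n (f g : ℕ → ℤ) → sumTo n (λ k → f k + g k) ≡ sumTo n f + sumTo n g
  sumTo-+ zero    f g = refl
  sumTo-+ (suc n) f g = trans (cong (_+ (f (suc n) + g (suc n))) (sumTo-+ n f g))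
                            (middle-swap (sumTo n f) (sumTo n g) (f (suc n)) (g (suc n)))
    where
    middle-swap : ∀ a b c d → a + b + (c + d) ≡ a + c + (b + d)
    middle-swap = solve-∀

  sumTo-minus : ∀ n (f g : ℕ → ℤ) → sumTo n (λ k → f k - g k) ≡ sumTo n f - sumTo n g
  sumTo-minus zero    f g = refl
  sumTo-minus (suc n) f g = trans (cong (_+ (f (suc n) - g (suc n))) (sumTo-minus n f g))
                            (middle-swap (sumTo n f) (sumTo n g) (f (suc n)) (g (suc n)))
    where
    middle-swap : ∀ a b c d → a - b + (c - d) ≡ a + c - (b + d)
    middle-swap = solve-∀

  sumTo-scale : ∀ n c (f : ℕ → ℤ) → sumTo n (λ k → c * f k) ≡ c * sumTo n f
  sumTo-scale zero    c f = refl
  sumTo-scale (suc n) c f =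
    trans (cong (_+ c * f (suc n)) (sumTo-scale n c f)) (sym (ℤ.*-distribˡ-+ c _ _))

  ⊛-congˡ : ∀ {p q} r i j → (∀ a b → p a b ≡ q a b) → (p ⊛ r) i j ≡ (q ⊛ r) i j
  ⊛-congˡ r i j p≗q =
    sumTo-cong i λ a → sumTo-cong j λ b → cong (_* r (i ∸ a) (j ∸ b)) (p≗q a b)

  ⊕-⊛ : ∀ p q r i j → ((p ⊕ q) ⊛ r) i j ≡ (p ⊛ r) i j + (q ⊛ r) i j
  ⊕-⊛ p q r i j =
    trans (sumTo-cong i λ a →
             trans (sumTo-cong j λ b → ℤ.*-distribʳ-+ (r (i ∸ a) (j ∸ b)) (p a b) (q a b))
                   (sumTo-+ j _ _))
          (sumTo-+ i _ _)

  ⊖-⊛ : ∀ p q r i j → ((p ⊖ q) ⊛ r) i j ≡ (p ⊛ r) i j - (q ⊛ r) i j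
  ⊖-⊛ p q r i j =
    trans (sumTo-cong i λ a →
             trans (sumTo-cong j λ b → distrib (p a b) (q a b) (r (i ∸ a) (j ∸ b)))
                   (sumTo-minus j _ _))
          (sumTo-minus i _ _)
    where
    distrib : ∀ x y z → (x - y) * z ≡ x * z - y * z
    distrib = solve-∀

  scale-⊛ : ∀ c p r i j → ((λ a b → c * p a b) ⊛ r) i j ≡ c * (p ⊛ r) i j
  scale-⊛ c p r i j =
    trans (sumTo-cong i λ a →
             trans (sumTo-cong j λ b → ℤ.*-assoc c (p a b) (r (i ∸ a) (j ∸ b)))
                   (sumTo-scale j c _))
          (sumTo-scale i c _)

  const-⊛ : ∀ c r i j → (const c ⊛ r) i j ≡ c * r i j
  const-⊛ c r i j = trans (sumTo-head i λ a → sumTo-zero j λ b → refl) (sumTo-head j λ b → refl)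

  xShift-⊛ : ∀ p r i j → (xShift p ⊛ r) i j ≡ xShift (p ⊛ r) i j
  xShift-⊛ p r zero    j = sumTo-zero j λ b → refl
  xShift-⊛ p r (suc i) j =
    trans (sumTo-suc i _) (trans (cong (_+ (p ⊛ r) i j) (sumTo-zero j λ b → refl)) (ℤ.+-identityˡ _))

  zShift-⊛ : ∀ p r i j → (zShift p ⊛ r) i j ≡ zShift (p ⊛ r) i j
  zShift-⊛ p r i zero    = sumTo-zero i λ a → refl
  zShift-⊛ p r i (suc j) = sumTo-cong i λ a → trans (sumTo-suc j _) (ℤ.+-identityˡ _)

  one-⊛ : ∀ r i j → (const (+ 1) ⊛ r) i j ≡ r i j
  one-⊛ r i j = trans (const-⊛ (+ 1) r i j) (ℤ.*-identityˡ (r i j))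

  X-⊛ : ∀ r i j → (X ⊛ r) i j ≡ xShift r i j
  X-⊛ r i j =
    trans (⊛-congˡ r i j X≗xShift-one) (trans (xShift-⊛ (const (+ 1)) r i j) (shift-cong i λ k → one-⊛ r k j))
    where
    X≗xShift-one : ∀ a b → X a b ≡ xShift (const (+ 1)) a b
    X≗xShift-one zero          b       = refl
    X≗xShift-one (suc zero)    zero    = refl
    X≗xShift-one (suc zero)    (suc b) = refl
    X≗xShift-one (suc (suc a)) zero    = refl
    X≗xShift-one (suc (suc a)) (suc b) = refl

  Z-⊛ : ∀ r i j → (Z ⊛ r) i j ≡ zShift r i j
  Z-⊛ r i j =
    trans (⊛-congˡ r i j Z≗zShift-one) (trans (zShift-⊛ (const (+ 1)) r i j) (shift-cong j λ l → one-⊛ r i l))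
    where
    Z≗zShift-one : ∀ a b → Z a b ≡ zShift (const (+ 1)) a b
    Z≗zShift-one zero    zero          = refl
    Z≗zShift-one (suc a) zero          = refl
    Z≗zShift-one zero    (suc zero)    = refl
    Z≗zShift-one (suc a) (suc zero)    = refl
    Z≗zShift-one zero    (suc (suc b)) = refl
    Z≗zShift-one (suc a) (suc (suc b)) = refl

  X⊛-⊛ : ∀ s r i j → ((X ⊛ s) ⊛ r) i j ≡ xShift (s ⊛ r) i j
  X⊛-⊛ s r i j = trans (⊛-congˡ r i j (X-⊛ s)) (xShift-⊛ s r i j)

  Z⊛-⊛ : ∀ s r i j → ((Z ⊛ s) ⊛ r) i j ≡ zShift (s ⊛ r) i j
  Z⊛-⊛ s r i j = trans (⊛-congˡ r i j (Z-⊛ s)) (zShift-⊛ s r i j)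

  const⊛-⊛ : ∀ c s r i j → ((const c ⊛ s) ⊛ r) i j ≡ c * (s ⊛ r) i j
  const⊛-⊛ c s r i j = trans (⊛-congˡ r i j (const-⊛ c s)) (scale-⊛ c s r i j)

  [1-X]-⊛ : ∀ r i j → ((const (+ 1) ⊖ X) ⊛ r) i j ≡ r i j - xShift r i j
  [1-X]-⊛ r i j = trans (⊖-⊛ (const (+ 1)) X r i j) (cong₂ _-_ (one-⊛ r i j) (X-⊛ r i j))

  [1-Z]-⊛ : ∀ r i j → ((const (+ 1) ⊖ Z) ⊛ r) i j ≡ r i j - zShift r i j
  [1-Z]-⊛ r i j = trans (⊖-⊛ (const (+ 1)) Z r i j) (cong₂ _-_ (one-⊛ r i j) (Z-⊛ r i j))

  [1+X]-⊛ : ∀ r i j → ((const (+ 1) ⊕ X) ⊛ r) i j ≡ r i j + xShift r i j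
  [1+X]-⊛ r i j = trans (⊕-⊛ (const (+ 1)) X r i j) (cong₂ _+_ (one-⊛ r i j) (X-⊛ r i j))

  x[1-x]∂x-coeff : ∀ r i j → (X ⊛ (const (+ 1) ⊖ X) ⊛ ∂x r) i j ≡ θx r i j - xShift (θx r) i j
  x[1-x]∂x-coeff r i j =
    trans (X⊛-⊛ (const (+ 1) ⊖ X) (∂x r) i j) (trans (shift-cong i λ k → [1-X]-⊛ (∂x r) k j) (shifted i))
    where
    shifted : ∀ i → shift (λ k → ∂x r k j - xShift (∂x r) k j) i ≡ θx r i j - xShift (θx r) i j
    shifted zero    = refl
    shifted (suc k) = cong (_-_ (∂x r k j)) (xShift-∂x r k j)

  z[1-z]∂z-coeff : ∀ r i j → (Z ⊛ (const (+ 1) ⊖ Z) ⊛ ∂z r) i j ≡ θz r i j - zShift (θz r) i j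
  z[1-z]∂z-coeff r i j =
    trans (Z⊛-⊛ (const (+ 1) ⊖ Z) (∂z r) i j) (trans (shift-cong j λ l → [1-Z]-⊛ (∂z r) i l) (shifted j))
    where
    shifted : ∀ j → shift (λ l → ∂z r i l - zShift (∂z r) i l) j ≡ θz r i j - zShift (θz r) i j
    shifted zero    = refl
    shifted (suc l) = cong (_-_ (∂z r i l)) (zShift-∂z r i l)

  x[1-z]∂z-coeff : ∀ r i j →
                   (X ⊛ (const (+ 1) ⊖ Z) ⊛ ∂z r) i j ≡ + suc j * xShift r i (suc j) - + j * xShift r i j
  x[1-z]∂z-coeff r i j =
    trans (X⊛-⊛ (const (+ 1) ⊖ Z) (∂z r) i j)
          (trans (shift-cong i λ k → trans ([1-Z]-⊛ (∂z r) k j) (cong (_-_ (∂z r k j)) (zShift-∂z r k j)))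
                 (shift-linear (+ suc j) (+ j) (λ k → r k (suc j)) (λ k → r k j) i))

  c[1+x]-coeff : ∀ c r i j → (const c ⊛ (const (+ 1) ⊕ X) ⊛ r) i j ≡ c * (r i j + xShift r i j)
  c[1+x]-coeff c r i j = trans (const⊛-⊛ c (const (+ 1) ⊕ X) r i j) (cong (c *_) ([1+X]-⊛ r i j))

  z+c[1+x]-coeff : ∀ c r i j →
                   ((Z ⊕ const c ⊛ (const (+ 1) ⊕ X)) ⊛ r) i j ≡ zShift r i j + c * (r i j + xShift r i j)
  z+c[1+x]-coeff c r i j =
    trans (⊕-⊛ Z (const c ⊛ (const (+ 1) ⊕ X)) r i j) (cong₂ _+_ (Z-⊛ r i j) (c[1+x]-coeff c r i j))

module Lists {A : Set} where

  open import Data.List using (cartesianProductWith)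
  open import Data.List.Membership.Propositional using (find)
  open import Data.List.Membership.Propositional.Properties using (∈-∃++; ∈-concatMap⁻)
  open import Data.List.Membership.Propositional.Properties.WithK using (unique∧set⇒bag)
  open import Data.List.Properties using (length-++-sucʳ)
  open import Data.List.Relation.Binary.BagAndSetEquality using (∼bag⇒↭)
  open import Data.List.Relation.Binary.Permutation.Setoid.Properties (setoid A) using (Unique-resp-↭)
  open import Data.List.Relation.Binary.Subset.Propositional using (_⊆_)
  open import Data.List.Relation.Unary.Unique.Propositional using (Unique; []; _∷_)
  import Data.List.Relation.Unary.Unique.Propositional.Properties as Unique
  open import Function.Bundles using (mk⇔)

  unique-↭ : ∀ {xs ys : List A} → xs ↭ ys → Unique xs → Unique ys
  unique-↭ xs↭ys = Unique-resp-↭ (↭⇒↭ₛ xs↭ys)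

  unique-⊆⇒↭ : ∀ {xs ys : List A} → Unique xs → Unique ys → xs ⊆ ys → ys ⊆ xs → xs ↭ ys
  unique-⊆⇒↭ u v xs⊆ys ys⊆xs = ∼bag⇒↭ (unique∧set⇒bag u v (mk⇔ xs⊆ys ys⊆xs))

  ∈-++-skip : ∀ {x y : A} us vs → x ∈ us ++ y ∷ vs → ¬ x ≡ y → x ∈ us ++ vs
  ∈-++-skip {y = y} us vs x∈ x≢y with ↭.∈-resp-↭ (↭.shift y us vs) x∈
  ... | here x≡y  = ⊥-elim (x≢y x≡y)
  ... | there x∈′ = x∈′

  unique-⊆⇒length-≤ : ∀ {xs ys : List A} → Unique xs → xs ⊆ ys → length xs ≤ length ys
  unique-⊆⇒length-≤ []                  xs⊆ys = z≤n
  unique-⊆⇒length-≤ {x ∷ xs} (x∉xs ∷ u) xs⊆ys with ∈-∃++ (xs⊆ys (here refl))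
  ... | us , vs , refl = subst (suc (length xs) ≤_) (sym (length-++-sucʳ us x vs))
          (s≤s (unique-⊆⇒length-≤ u λ z∈xs →
                  ∈-++-skip us vs (xs⊆ys (there z∈xs)) λ z≡x → All.lookup x∉xs z∈xs (sym z≡x)))

  concatMap-unique : ∀ {B : Set} {f : A → List B} (tag : B → A) {xs} → Unique xs →
                     (∀ {x} → x ∈ xs → Unique (f x)) →
                     (∀ {x y} → x ∈ xs → y ∈ f x → tag y ≡ x) →
                     Unique (concatMap f xs)
  concatMap-unique tag [] unique-f tagged = []
  concatMap-unique {f = f} tag {x ∷ xs} (x∉xs ∷ u) unique-f tagged =
    Unique.++⁺ (unique-f (here refl)) (concatMap-unique tag u (unique-f ∘ there) (tagged ∘ there)) disjoint
    where
    disjoint : ∀ {y} → ¬ (y ∈ f x × y ∈ concatMap f xs)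
    disjoint (y∈fx , y∈rest) with find (∈-concatMap⁻ f y∈rest)
    ... | x′ , x′∈xs , y∈fx′ =
      All.lookup x∉xs x′∈xs (trans (sym (tagged (here refl) y∈fx)) (tagged (there x′∈xs) y∈fx′))

  concatMap-map≡cartesianProductWith : ∀ {B C : Set} (f : A → B → C) xs ys →
    concatMap (λ x → map (f x) ys) xs ≡ cartesianProductWith f xs ys
  concatMap-map≡cartesianProductWith f []       ys = refl
  concatMap-map≡cartesianProductWith f (x ∷ xs) ys =
    cong (map (f x) ys ++_) (concatMap-map≡cartesianProductWith f xs ys)

module Permutations where

  open import Data.List using (upTo; cartesianProductWith)
  open import Data.List.Membership.DecPropositional _≟_ using (_∈?_)
  open import Data.List.Membership.Propositional using (_∉_; find; lose)
  open import Data.List.Membership.Propositional.Properties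
    using ( ∈-∃++; ∈-concatMap⁺; ∈-concatMap⁻; ∈-filter⁺; ∈-filter⁻; ∈-map⁺; ∈-map⁻; ∈-upTo⁺; ∈-upTo⁻
          ; ∈-cartesianProductWith⁺; ∈-cartesianProductWith⁻)
  open import Data.List.Properties
    using ( ∷-injective; ∷-injectiveˡ; ∷-injectiveʳ; length-++-sucʳ; length-map; length-upTo
          ; filter-++; filter-all; filter-reject)
  open import Data.List.Relation.Binary.Subset.Propositional using (_⊆_)
  open import Data.List.Relation.Unary.All.Properties using (¬Any⇒All¬)
  open import Data.List.Relation.Unary.AllPairs using (allPairs?)
  open import Data.List.Relation.Unary.Unique.Propositional using (Unique; []; _∷_)
  import Data.List.Relation.Unary.Unique.Propositional.Properties as Unique
  open import Data.Product using (∃₂)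
  open import Relation.Nullary using (yes; no)
  open import Relation.Nullary.Decidable using (¬?)

  open Lists

  oneTo : ℕ → List ℕ
  oneTo n = map suc (upTo n)

  oneTo-unique : ∀ n → Unique (oneTo n)
  oneTo-unique n = Unique.map⁺ ℕ.suc-injective (Unique.upTo⁺ n)

  length-oneTo : ∀ n → length (oneTo n) ≡ n
  length-oneTo n = trans (length-map suc (upTo n)) (length-upTo n)

  max∈oneTo : ∀ m → suc m ∈ oneTo (suc m)
  max∈oneTo m = ∈-map⁺ suc (∈-upTo⁺ (ℕ.n<1+n m))

  max∉oneTo : ∀ m → suc m ∉ oneTo m
  max∉oneTo m a∈ with ∈-map⁻ suc a∈
  ... | k , k<m , refl = ℕ.n≮n k (∈-upTo⁻ k<m)

  ∈-oneTo-suc : ∀ {m a} → a ∈ oneTo m → a ∈ oneTo (suc m)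
  ∈-oneTo-suc a∈ with ∈-map⁻ suc a∈
  ... | k , k∈ , refl = ∈-map⁺ suc (∈-upTo⁺ (ℕ.m<n⇒m<1+n (∈-upTo⁻ k∈)))

  ∈-oneTo-pred : ∀ {m a} → a ∈ oneTo (suc m) → ¬ a ≡ suc m → a ∈ oneTo m
  ∈-oneTo-pred a∈ a≢max with ∈-map⁻ suc a∈
  ... | k , k∈ , refl =
    ∈-map⁺ suc (∈-upTo⁺ (ℕ.≤∧≢⇒< (ℕ.≤-pred (∈-upTo⁻ k∈)) (a≢max ∘ cong suc)))

  ∈-oneTo⇒< : ∀ {m a} → a ∈ oneTo m → a < suc m
  ∈-oneTo⇒< a∈ with ∈-map⁻ suc a∈
  ... | k , k∈ , refl = s≤s (∈-upTo⁻ k∈)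

  words-suc : ∀ n k → words n (suc k) ≡ cartesianProductWith _∷_ (oneTo n) (words n k)
  words-suc n k = concatMap-map≡cartesianProductWith _∷_ (oneTo n) (words n k)

  ∈-words⁻ : ∀ n k {σ} → σ ∈ words n k → length σ ≡ k × All (_∈ oneTo n) σ
  ∈-words⁻ n zero    (here refl) = refl , []
  ∈-words⁻ n (suc k) σ∈ rewrite words-suc n k
    with a , τ , a∈ , τ∈ , refl ← ∈-cartesianProductWith⁻ _∷_ (oneTo n) (words n k) σ∈
    with refl , all ← ∈-words⁻ n k τ∈ = refl , a∈ ∷ all

  ∈-words⁺ : ∀ n {σ} → All (_∈ oneTo n) σ → σ ∈ words n (length σ)
  ∈-words⁺ n []                 = here refl
  ∈-words⁺ n {a ∷ σ} (a∈ ∷ all) rewrite words-suc n (length σ) =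
    ∈-cartesianProductWith⁺ _∷_ a∈ (∈-words⁺ n all)

  words-unique : ∀ n k → Unique (words n k)
  words-unique n zero    = [] ∷ []
  words-unique n (suc k) rewrite words-suc n k =
    Unique.cartesianProductWith⁺ _∷_ ∷-injective (oneTo-unique n) (words-unique n k)

  unique-⊆-length⇒⊇ : ∀ {xs ys : List ℕ} → Unique xs → xs ⊆ ys → length ys ≤ length xs → ys ⊆ xs
  unique-⊆-length⇒⊇ {xs} u xs⊆ys ys≤xs {y} y∈ys with y ∈? xs
  ... | yes y∈xs = y∈xs
  ... | no  y∉xs with ∈-∃++ y∈ys
  ...   | us , vs , refl = ⊥-elim (ℕ.n≮n (length (us ++ vs))
            (ℕ.≤-trans (subst (_≤ length xs) (length-++-sucʳ us y vs) ys≤xs)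
                       (unique-⊆⇒length-≤ u λ x∈xs →
                          ∈-++-skip us vs (xs⊆ys x∈xs) λ { refl → y∉xs x∈xs })))

  IsPerm : ℕ → List ℕ → Set
  IsPerm n σ = Unique σ × length σ ≡ n × All (_∈ oneTo n) σ

  distinct? : Decidable Unique
  distinct? = allPairs? (λ x y → ¬? (x ≟ y))

  ∈-Perms⁻ : ∀ n {σ} → σ ∈ Perms n → IsPerm n σ
  ∈-Perms⁻ n σ∈ with σ∈words , u ← ∈-filter⁻ distinct? {xs = words n n} σ∈
    with len , all ← ∈-words⁻ n n σ∈words = u , len , all

  ∈-Perms⁺ : ∀ n {σ} → IsPerm n σ → σ ∈ Perms n
  ∈-Perms⁺ n (u , refl , all) = ∈-filter⁺ distinct? (∈-words⁺ n all) u

  Perms-unique : ∀ n → Unique (Perms n)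
  Perms-unique n = Unique.filter⁺ distinct? (words-unique n n)

  IsPerm-↭ : ∀ {n σ τ} → σ ↭ τ → IsPerm n σ → IsPerm n τ
  IsPerm-↭ σ↭τ (u , len , all) =
    unique-↭ σ↭τ u , trans (sym (↭.↭-length σ↭τ)) len , ↭.All-resp-↭ σ↭τ all

  IsPerm⇒↭oneTo : ∀ n {σ} → IsPerm n σ → σ ↭ oneTo n
  IsPerm⇒↭oneTo n {σ} (u , len , all) =
    unique-⊆⇒↭ u (oneTo-unique n) σ⊆oneTo
      (unique-⊆-length⇒⊇ u σ⊆oneTo (ℕ.≤-reflexive (trans (length-oneTo n) (sym len))))
    where
    σ⊆oneTo : σ ⊆ oneTo n
    σ⊆oneTo = All.lookup all

  insertions : ℕ → List ℕ → List (List ℕ)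
  insertions N []      = (N ∷ []) ∷ []
  insertions N (a ∷ w) = (N ∷ a ∷ w) ∷ map (a ∷_) (insertions N w)

  ∈-insertions⁺ : ∀ N us vs → us ++ N ∷ vs ∈ insertions N (us ++ vs)
  ∈-insertions⁺ N []       []       = here refl
  ∈-insertions⁺ N []       (b ∷ vs) = here refl
  ∈-insertions⁺ N (a ∷ us) vs       = there (∈-map⁺ (a ∷_) (∈-insertions⁺ N us vs))

  ∈-insertions⁻ : ∀ N σ {τ} → τ ∈ insertions N σ →
                  ∃₂ λ us vs → σ ≡ us ++ vs × τ ≡ us ++ N ∷ vs
  ∈-insertions⁻ N []      (here refl) = [] , [] , refl , refl
  ∈-insertions⁻ N (a ∷ w) (here refl) = [] , a ∷ w , refl , refl
  ∈-insertions⁻ N (a ∷ w) (there τ∈)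
    with τ , τ∈insertions , refl ← ∈-map⁻ (a ∷_) τ∈
    with us , vs , refl , refl ← ∈-insertions⁻ N w τ∈insertions = a ∷ us , vs , refl , refl

  insertions-unique : ∀ N {σ} → N ∉ σ → Unique (insertions N σ)
  insertions-unique N {[]}    N∉σ = [] ∷ []
  insertions-unique N {a ∷ w} N∉σ =
    All.tabulate front-new ∷ Unique.map⁺ ∷-injectiveʳ (insertions-unique N (N∉σ ∘ there))
    where
    front-new : ∀ {τ} → τ ∈ map (a ∷_) (insertions N w) → ¬ N ∷ a ∷ w ≡ τ
    front-new τ∈ eq with _ , _ , refl ← ∈-map⁻ (a ∷_) τ∈ = N∉σ (here (∷-injectiveˡ eq))

  remove : ℕ → List ℕ → List ℕ
  remove N = filter (λ x → ¬? (N ≟ x))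

  remove-insertions : ∀ N {σ τ} → N ∉ σ → τ ∈ insertions N σ → remove N τ ≡ σ
  remove-insertions N {σ} N∉σ τ∈ with us , vs , refl , refl ← ∈-insertions⁻ N σ τ∈ = begin
    remove N (us ++ N ∷ vs)            ≡⟨ filter-++ N≢? us (N ∷ vs) ⟩
    remove N us ++ remove N (N ∷ vs)   ≡⟨ cong (remove N us ++_) (filter-reject N≢? (λ N≢N → N≢N refl)) ⟩
    remove N us ++ remove N vs         ≡⟨ filter-++ N≢? us vs ⟨
    remove N (us ++ vs)                ≡⟨ filter-all N≢? (¬Any⇒All¬ (us ++ vs) N∉σ) ⟩
    us ++ vs                           ∎
    where
    open ≡-Reasoning
    N≢? = λ x → ¬? (N ≟ x)

  Perms-suc↭ : ∀ m → Perms (suc m) ↭ concatMap (insertions (suc m)) (Perms m)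
  Perms-suc↭ m = unique-⊆⇒↭ (Perms-unique (suc m)) all-insertions-unique to from
    where
    N = suc m

    N∉ : ∀ {σ} → σ ∈ Perms m → N ∉ σ
    N∉ σ∈ N∈σ with _ , _ , all ← ∈-Perms⁻ m σ∈ = max∉oneTo m (All.lookup all N∈σ)

    all-insertions-unique : Unique (concatMap (insertions N) (Perms m))
    all-insertions-unique = concatMap-unique (remove N) (Perms-unique m)
      (λ σ∈ → insertions-unique N (N∉ σ∈)) (λ σ∈ τ∈ → remove-insertions N (N∉ σ∈) τ∈)

    remove-max : ∀ us vs → IsPerm N (us ++ N ∷ vs) → IsPerm m (us ++ vs)
    remove-max us vs τ-perm with N∉ρ ∷ u , len , _ ∷ all ← IsPerm-↭ (↭.shift N us vs) τ-perm =
      u , ℕ.suc-injective len ,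
      All.tabulate λ a∈ → ∈-oneTo-pred (All.lookup all a∈) λ a≡N → All.lookup N∉ρ a∈ (sym a≡N)

    insert-max : ∀ us vs → IsPerm m (us ++ vs) → IsPerm N (us ++ N ∷ vs)
    insert-max us vs (u , len , all) = IsPerm-↭ (↭-sym (↭.shift N us vs))
      ( All.tabulate (λ a∈ N≡a → max∉oneTo m (subst (_∈ oneTo m) (sym N≡a) (All.lookup all a∈))) ∷ u
      , cong suc len
      , max∈oneTo m ∷ All.map ∈-oneTo-suc all)

    to : Perms N ⊆ concatMap (insertions N) (Perms m)
    to τ∈ with τ-perm ← ∈-Perms⁻ N τ∈
      with us , vs , refl ← ∈-∃++ (↭.∈-resp-↭ (↭-sym (IsPerm⇒↭oneTo N τ-perm)) (max∈oneTo m)) =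
      ∈-concatMap⁺ (insertions N) (lose (∈-Perms⁺ m (remove-max us vs τ-perm)) (∈-insertions⁺ N us vs))

    from : concatMap (insertions N) (Perms m) ⊆ Perms N
    from τ∈ with σ , σ∈ , τ∈insertions ← find (∈-concatMap⁻ (insertions N) τ∈)
      with us , vs , refl , refl ← ∈-insertions⁻ N σ τ∈insertions =
      ∈-Perms⁺ N (insert-max us vs (∈-Perms⁻ m σ∈))

module Insertion where

  open import Data.Integer using (_+_; _*_; _-_)
  open import Data.List using (upTo; downFrom)
  open import Data.List.Properties using (reverse-upTo)
  open import Data.Nat using (_<ᵇ_; ⌈_/2⌉)
  open import Data.Nat.ListAction using (sum)
  open import Data.Nat.ListAction.Properties using (sum-↭)
  import Data.Nat.Tactic.RingSolver as ℕ-Ring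
  open import Data.Unit using (tt)
  open Sums
  open Permutations

  χ : Bool → ℕ
  χ b = if b then 1 else 0

  oddCount : List ℕ → ℕ
  oddCount w = sum (map (χ ∘ isOdd) w)

  oddAscents : ℕ → List ℕ → ℕ
  oddAscents a []      = 0
  oddAscents a (b ∷ w) = (if b <ᵇ a then 0 else χ (isOdd b)) ℕ.+ oddAscents b w

  oddAscents+desO : ∀ a w → oddAscents a w ℕ.+ desO (a ∷ w) ≡ oddCount w
  oddAscents+desO a []      = refl
  oddAscents+desO a (b ∷ w) =
    trans (interchange ascent (oddAscents b w) descent (desO (b ∷ w)))
          (cong₂ ℕ._+_ (ascent+descent (b <ᵇ a) (isOdd b)) (oddAscents+desO b w))
    where
    ascent  = if b <ᵇ a then 0 else χ (isOdd b)
    descent = if b <ᵇ a then χ (isOdd b) else 0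
    interchange : ∀ x y z u → (x ℕ.+ y) ℕ.+ (z ℕ.+ u) ≡ (x ℕ.+ z) ℕ.+ (y ℕ.+ u)
    interchange = ℕ-Ring.solve-∀
    ascent+descent : ∀ s o → (if s then 0 else χ o) ℕ.+ (if s then χ o else 0) ≡ χ o
    ascent+descent true  o = refl
    ascent+descent false o = ℕ.+-identityʳ (χ o)

  desO-below-max : ∀ {N} a w → a < N → desO (a ∷ N ∷ w) ≡ desO (N ∷ w)
  desO-below-max {N} a w a<N with N <ᵇ a | ℕ.<ᵇ⇒< N a
  ... | false | _   = refl
  ... | true  | N<a = ⊥-elim (ℕ.<-asym a<N (N<a tt))

  desO-max-first : ∀ {N} b w → b < N → desO (N ∷ b ∷ w) ≡ χ (isOdd b) ℕ.+ desO (b ∷ w)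
  desO-max-first {N} b w b<N with b <ᵇ N | ℕ.<⇒<ᵇ b<N
  ... | true | _ = refl

  plain-slot : ∀ x y L O → x + ((L - O) * x + O * y) ≡ (+ 1 + L - O) * x + O * y
  plain-slot = solve-∀

  rising-slot : ∀ x y L O → y + ((L - O) * x + O * y) ≡ (+ 1 + L - (+ 1 + O)) * x + (+ 1 + O) * y
  rising-slot = solve-∀

  -- For consecutive letters a b, with s = b <ᵇ a and o = isOdd b: inserting a new
  -- maximum just before b keeps desO, unless b is odd and not smaller than a, in
  -- which case it creates one odd descent.
  slot-step : ∀ (g : ℕ → ℤ) s o d L O →
    let descent = if s then χ o else 0
        ascent  = if s then 0 else χ o
    in g (χ o ℕ.+ d) + ((+ suc L - + O) * g (descent ℕ.+ d) + + O * g (descent ℕ.+ suc d))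
       ≡ (+ suc (suc L) - + (ascent ℕ.+ O)) * g (descent ℕ.+ d) + + (ascent ℕ.+ O) * g (suc (descent ℕ.+ d))
  slot-step g true  true  d L O = plain-slot (g (suc d)) (g (suc (suc d))) (+ suc L) (+ O)
  slot-step g true  false d L O = plain-slot (g d) (g (suc d)) (+ suc L) (+ O)
  slot-step g false true  d L O = rising-slot (g d) (g (suc d)) (+ suc L) (+ O)
  slot-step g false false d L O = plain-slot (g d) (g (suc d)) (+ suc L) (+ O)

  sumBy-desO-insertions : ∀ (g : ℕ → ℤ) {N} a w → a < N → All (_< N) w →
    sumBy (λ τ → g (desO (a ∷ τ))) (insertions N w)
      ≡ (+ suc (length w) - + oddAscents a w) * g (desO (a ∷ w)) + + oddAscents a w * g (suc (desO (a ∷ w)))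
  sumBy-desO-insertions g {N} a []      a<N []          =
    trans (cong (λ d → g d + + 0) (desO-below-max a [] a<N)) (single (g 0))
    where
    single : ∀ x → x + + 0 ≡ (+ 1 - + 0) * x + + 0
    single = solve-∀
  sumBy-desO-insertions g {N} a (b ∷ w) a<N (b<N ∷ w<N) = begin
      g (desO (a ∷ N ∷ b ∷ w)) + sumBy (λ τ → g (desO (a ∷ τ))) (map (b ∷_) (insertions N w))
    ≡⟨ cong₂ _+_ (cong g (trans (desO-below-max a (b ∷ w) a<N) (desO-max-first b w b<N)))
                 (sumBy-map (λ τ → g (desO (a ∷ τ))) (b ∷_) (insertions N w)) ⟩
      g (χ (isOdd b) ℕ.+ desO (b ∷ w)) + sumBy (λ τ → g (desO (a ∷ b ∷ τ))) (insertions N w)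
    ≡⟨ cong (_+_ (g (χ (isOdd b) ℕ.+ desO (b ∷ w))))
            (sumBy-desO-insertions (λ d → g (descent ℕ.+ d)) b w b<N w<N) ⟩
      g (χ (isOdd b) ℕ.+ desO (b ∷ w))
        + ((+ suc (length w) - + oddAscents b w) * g (descent ℕ.+ desO (b ∷ w))
           + + oddAscents b w * g (descent ℕ.+ suc (desO (b ∷ w))))
    ≡⟨ slot-step g (b <ᵇ a) (isOdd b) (desO (b ∷ w)) (length w) (oddAscents b w) ⟩
      (+ suc (length (b ∷ w)) - + oddAscents a (b ∷ w)) * g (desO (a ∷ b ∷ w))
        + + oddAscents a (b ∷ w) * g (suc (desO (a ∷ b ∷ w)))
    ∎
    where
    open ≡-Reasoning
    descent = if b <ᵇ a then χ (isOdd b) else 0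

  oddCount-downFrom : ∀ m → oddCount (map suc (downFrom m)) ≡ ⌈ m /2⌉
  oddCount-downFrom zero          = refl
  oddCount-downFrom (suc zero)    = refl
  oddCount-downFrom (suc (suc m)) =
    trans (sym (ℕ.+-assoc (χ (isOdd m)) (χ (isOdd (suc m))) _))
          (cong₂ ℕ._+_ (consecutive m) (oddCount-downFrom m))
    where
    consecutive : ∀ m → χ (isOdd m) ℕ.+ χ (isOdd (suc m)) ≡ 1
    consecutive zero          = refl
    consecutive (suc zero)    = refl
    consecutive (suc (suc m)) = consecutive m

  oddCount-oneTo : ∀ m → oddCount (oneTo m) ≡ ⌈ m /2⌉
  oddCount-oneTo m = trans (sum-↭ (↭.map⁺ (χ ∘ isOdd) (↭.map⁺ suc upTo↭downFrom))) (oddCount-downFrom m)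
    where
    upTo↭downFrom : upTo m ↭ downFrom m
    upTo↭downFrom = subst (upTo m ↭_) (reverse-upTo m) (↭-sym (↭.↭-reverse (upTo m)))

module Counting where

  open import Data.Integer using (_+_; _*_; _-_)
  open import Data.Nat.ListAction.Properties using (sum-↭)
  open import Relation.Nullary using (no; yes)
  open import Relation.Nullary.Decidable using (dec-true; dec-false)
  open Sums
  open Coefficients using (shift; shift-cong; shift-zero)
  open Permutations
  open Insertion

  δ : ℕ → ℕ → ℤ
  δ m n = iverson (m ≟ n)

  δ-≡ : ∀ {n} → δ n n ≡ + 1
  δ-≡ {n} = cong (if_then + 1 else + 0) (dec-true (n ≟ n) refl)

  δ-≢ : ∀ {m n} → ¬ m ≡ n → δ m n ≡ + 0
  δ-≢ {m} {n} m≢n = cong (if_then + 1 else + 0) (dec-false (m ≟ n) m≢n)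

  δ-select : ∀ c j d i (x y : ℤ) → (c ≡ j → d ≡ i → x ≡ y) →
             δ c j * (x * δ d i) ≡ y * (δ c j * δ d i)
  δ-select c j d i x y x≡y with c ≟ j
  ... | no c≢j rewrite δ-≢ c≢j = sym (ℤ.*-zeroʳ y)
  ... | yes refl with d ≟ i
  ...   | no d≢i rewrite δ-≢ d≢i | δ-≡ {c} = off x y
    where
    off : ∀ x y → + 1 * (x * + 0) ≡ y * (+ 1 * + 0)
    off = solve-∀
  ...   | yes refl rewrite δ-≡ {c} | δ-≡ {d} | x≡y refl refl = on y
    where
    on : ∀ y → + 1 * (y * + 1) ≡ y * (+ 1 * + 1)
    on = solve-∀

  δ-χ+ : ∀ b d i → δ (χ b ℕ.+ d) i ≡ δ (χ b) 0 * δ d i + shift (λ k → δ (χ b) 1 * δ d k) i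
  δ-χ+ false d i       =
    sym (trans (cong₂ _+_ (ℤ.*-identityˡ (δ d i)) (shift-zero i λ _ → refl)) (ℤ.+-identityʳ _))
  δ-χ+ true  d zero    = refl
  δ-χ+ true  d (suc k) = sym (trans (ℤ.+-identityˡ _) (ℤ.*-identityˡ (δ d k)))

  coeff : ℕ → ℕ → List ℕ → ℤ
  coeff i j σ = δ (chiFirstOdd σ) j * δ (desO σ) i

  -- The coefficient of x^i z^j in Q (m+1), computed from r = Q m, where Nodd is
  -- the parity of m+1 and p, o are the numbers of even and odd letters in [m].
  insertionStep : Bool → ℕ → ℕ → Poly → Poly
  insertionStep Nodd p o r i j =
    δ (χ Nodd) j * (r i 0 + shift (λ k → r k 1) i)
    + (+ p + + j + + i) * r i j
    + shift (λ k → (+ o - + j - + k) * r k j) i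

  sumBy-coeff-insertions : ∀ {N} a w p o → a < N → All (_< N) w →
                    p ℕ.+ o ≡ suc (length w) → oddCount (a ∷ w) ≡ o → ∀ i j →
                    sumBy (coeff i j) (insertions N (a ∷ w))
                      ≡ insertionStep (isOdd N) p o (λ i j → coeff i j (a ∷ w)) i j
  sumBy-coeff-insertions {N} a w p o a<N w<N p+o≡length oddCount≡o i j = begin
      δ e j * δ (desO (N ∷ a ∷ w)) i + sumBy (coeff i j) (map (a ∷_) (insertions N w))
    ≡⟨ cong₂ _+_ (cong (λ n → δ e j * δ n i) (desO-max-first a w a<N))
                 (sumBy-map (coeff i j) (a ∷_) (insertions N w)) ⟩
      δ e j * δ (c ℕ.+ d) i + sumBy (λ τ → δ c j * δ (desO (a ∷ τ)) i) (insertions N w)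
    ≡⟨ cong (_+_ (δ e j * δ (c ℕ.+ d) i))
            (trans (sumBy-scale (δ c j) (λ τ → δ (desO (a ∷ τ)) i) (insertions N w))
                   (cong (δ c j *_) (sumBy-desO-insertions (λ n → δ n i) a w a<N w<N))) ⟩
      δ e j * δ (c ℕ.+ d) i + δ c j * ((+ suc (length w) - + O) * δ d i + + O * δ (suc d) i)
    ≡⟨ cong (_+_ (δ e j * δ (c ℕ.+ d) i)) (ℤ.*-distribˡ-+ (δ c j) _ _) ⟩
      δ e j * δ (c ℕ.+ d) i + (δ c j * ((+ suc (length w) - + O) * δ d i) + δ c j * (+ O * δ (suc d) i))
    ≡⟨ cong₂ _+_ (cong (δ e j *_) (δ-χ+ (isOdd a) d i)) (cong₂ _+_ unchanged-slots (raising-slots i)) ⟩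
      δ e j * (coeff i 0 σ + shift (λ k → coeff k 1 σ) i)
        + ((+ p + + j + + i) * coeff i j σ + shift (λ k → (+ o - + j - + k) * coeff k j σ) i)
    ≡⟨ sym (ℤ.+-assoc (δ e j * (coeff i 0 σ + shift (λ k → coeff k 1 σ) i)) _ _) ⟩
      insertionStep (isOdd N) p o (λ i j → coeff i j σ) i j
    ∎
    where
    open ≡-Reasoning
    σ = a ∷ w
    e = χ (isOdd N)
    c = χ (isOdd a)
    d = desO σ
    O = oddAscents a w

    odd-split : o ≡ c ℕ.+ (O ℕ.+ d)
    odd-split = trans (sym oddCount≡o) (cong (c ℕ.+_) (sym (oddAscents+desO a w)))

    unchanged-slots : δ c j * ((+ suc (length w) - + O) * δ d i) ≡ (+ p + + j + + i) * coeff i j σ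
    unchanged-slots = δ-select c j d i (+ suc (length w) - + O) (+ p + + j + + i) λ { refl refl →
      trans (cong (λ n → + n - + O) (trans (sym p+o≡length) (cong (p ℕ.+_) odd-split)))
            (cancel (+ p) (+ c) (+ O) (+ d)) }
      where
      cancel : ∀ P C O D → P + (C + (O + D)) - O ≡ P + C + D
      cancel = solve-∀

    raising-slots : ∀ i → δ c j * (+ O * δ (suc d) i) ≡ shift (λ k → (+ o - + j - + k) * coeff k j σ) i
    raising-slots zero    = trans (cong (δ c j *_) (ℤ.*-zeroʳ (+ O))) (ℤ.*-zeroʳ (δ c j))
    raising-slots (suc k) = δ-select c j d k (+ O) (+ o - + j - + k) λ { refl refl →
      sym (trans (cong (λ n → + n - + c - + d) odd-split) (cancel (+ c) (+ O) (+ d))) }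
      where
      cancel : ∀ C O D → C + (O + D) - C - D ≡ O
      cancel = solve-∀

  Q≡sumBy : ∀ m i j → Q m i j ≡ sumBy (coeff i j) (Perms m)
  Q≡sumBy m i j = trans (length-filter (λ σ → desO σ ≟ i) (filter (λ σ → chiFirstOdd σ ≟ j) (Perms m)))
                        (sumBy-filter (λ σ → chiFirstOdd σ ≟ j) (λ σ → δ (desO σ) i) (Perms m))

  sumBy-shift : ∀ {A : Set} (f : A → ℕ → ℤ) xs i →
                sumBy (λ x → shift (f x) i) xs ≡ shift (λ k → sumBy (λ x → f x k) xs) i
  sumBy-shift f xs zero    = sumBy-zero xs
  sumBy-shift f xs (suc k) = refl

  insertionStep-sumBy : ∀ {A : Set} Nodd p o (r : A → Poly) xs i j →
    sumBy (λ x → insertionStep Nodd p o (r x) i j) xs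
      ≡ insertionStep Nodd p o (λ a b → sumBy (λ x → r x a b) xs) i j
  insertionStep-sumBy Nodd p o r xs i j =
    trans (sumBy-+ (λ x → front x + unchanged x) raised xs)
          (cong₂ _+_ (trans (sumBy-+ front unchanged xs) (cong₂ _+_ sum-front sum-unchanged)) sum-raised)
    where
    front unchanged raised : _ → ℤ
    front     x = δ (χ Nodd) j * (r x i 0 + shift (λ k → r x k 1) i)
    unchanged x = (+ p + + j + + i) * r x i j
    raised    x = shift (λ k → (+ o - + j - + k) * r x k j) i

    sum-front = trans (sumBy-scale (δ (χ Nodd) j) (λ x → r x i 0 + shift (λ k → r x k 1) i) xs)
      (cong (δ (χ Nodd) j *_) (trans (sumBy-+ (λ x → r x i 0) (λ x → shift (λ k → r x k 1) i) xs)
                                     (cong (_+_ (sumBy (λ x → r x i 0) xs)) (sumBy-shift (λ x k → r x k 1) xs i))))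
    sum-unchanged = sumBy-scale (+ p + + j + + i) (λ x → r x i j) xs
    sum-raised = trans (sumBy-shift (λ x k → (+ o - + j - + k) * r x k j) xs i)
                       (shift-cong i λ k → sumBy-scale (+ o - + j - + k) (λ x → r x k j) xs)

  insertionStep-cong : ∀ Nodd p o {r r′ : Poly} → (∀ a b → r a b ≡ r′ a b) → ∀ i j →
                       insertionStep Nodd p o r i j ≡ insertionStep Nodd p o r′ i j
  insertionStep-cong Nodd p o r≗r′ i j =
    cong₂ _+_ (cong₂ _+_ (cong (δ (χ Nodd) j *_) (cong₂ _+_ (r≗r′ i 0) (shift-cong i λ k → r≗r′ k 1)))
                         (cong ((+ p + + j + + i) *_) (r≗r′ i j)))
              (shift-cong i λ k → cong ((+ o - + j - + k) *_) (r≗r′ k j))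

  Q-suc : ∀ m p o → 1 ≤ m → p ℕ.+ o ≡ m → oddCount (oneTo m) ≡ o → ∀ i j →
          Q (suc m) i j ≡ insertionStep (isOdd (suc m)) p o (Q m) i j
  Q-suc m p o 1≤m p+o≡m oddCount≡o i j = begin
      Q (suc m) i j
    ≡⟨ Q≡sumBy (suc m) i j ⟩
      sumBy (coeff i j) (Perms (suc m))
    ≡⟨ sumBy-↭ (coeff i j) (Perms-suc↭ m) ⟩
      sumBy (coeff i j) (concatMap (insertions (suc m)) (Perms m))
    ≡⟨ sumBy-concatMap (coeff i j) (insertions (suc m)) (Perms m) ⟩
      sumBy (λ σ → sumBy (coeff i j) (insertions (suc m) σ)) (Perms m)
    ≡⟨ sumBy-cong (Perms m) (λ σ∈ → each-perm (∈-Perms⁻ m σ∈)) ⟩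
      sumBy (λ σ → insertionStep (isOdd (suc m)) p o (λ i j → coeff i j σ) i j) (Perms m)
    ≡⟨ insertionStep-sumBy (isOdd (suc m)) p o (λ σ i j → coeff i j σ) (Perms m) i j ⟩
      insertionStep (isOdd (suc m)) p o (λ i j → sumBy (coeff i j) (Perms m)) i j
    ≡⟨ insertionStep-cong (isOdd (suc m)) p o (Q≡sumBy m) i j ⟨
      insertionStep (isOdd (suc m)) p o (Q m) i j
    ∎
    where
    open ≡-Reasoning
    each-perm : ∀ {σ} → IsPerm m σ →
                sumBy (coeff i j) (insertions (suc m) σ)
                  ≡ insertionStep (isOdd (suc m)) p o (λ i j → coeff i j σ) i j
    each-perm {[]}    (_ , length≡m , _) = ⊥-elim (ℕ.<⇒≢ 1≤m length≡m)
    each-perm {a ∷ w} σ-perm@(_ , length≡m , a∈ ∷ w∈) =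
      sumBy-coeff-insertions a w p o (∈-oneTo⇒< a∈) (All.map ∈-oneTo⇒< w∈) (trans p+o≡m (sym length≡m))
        (trans (sum-↭ (↭.map⁺ (χ ∘ isOdd) (IsPerm⇒↭oneTo m σ-perm))) oddCount≡o) i j

module Recurrences where

  open import Data.Integer using (_+_; _*_; _-_)
  open Sums using (sumBy-cong; sumBy-zero)
  open Coefficients
  open Counting using (δ; coeff; insertionStep; Q≡sumBy)

  LinearInZ : Poly → Set
  LinearInZ r = ∀ i l → r i (suc (suc l)) ≡ + 0

  Q-linearInZ : ∀ m → LinearInZ (Q m)
  Q-linearInZ m i l =
    trans (Q≡sumBy m i (suc (suc l))) (trans (sumBy-cong (Perms m) λ {σ} _ → high-row σ) (sumBy-zero (Perms m)))
    where
    high-row : ∀ σ → coeff i (suc (suc l)) σ ≡ + 0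
    high-row []      = refl
    high-row (a ∷ w) with isOdd a
    ... | true  = refl
    ... | false = refl

  xShift-high : ∀ r → LinearInZ r → ∀ i l → xShift r i (suc (suc l)) ≡ + 0
  xShift-high r linear i l = shift-zero i λ k → linear k l

  xShift-θx-high : ∀ r → LinearInZ r → ∀ i l → xShift (θx r) i (suc (suc l)) ≡ + 0
  xShift-θx-high r linear i l = shift-zero i λ k → trans (cong (+ k *_) (linear k l)) (ℤ.*-zeroʳ (+ k))

  θz-positive : ∀ r → LinearInZ r → ∀ i l → θz r i (suc l) ≡ r i (suc l)
  θz-positive r linear i zero    = ℤ.*-identityˡ _
  θz-positive r linear i (suc l) =
    trans (cong (+ suc (suc l) *_) (linear i l)) (trans (ℤ.*-zeroʳ (+ suc (suc l))) (sym (linear i l)))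

  odd-insertionStep : ∀ r → LinearInZ r → ∀ n i j →
    insertionStep true n n r i j
      ≡ (X ⊛ (const (+ 1) ⊖ X) ⊛ ∂x r
         ⊕ Z ⊛ (const (+ 1) ⊖ Z) ⊛ ∂z r
         ⊕ (Z ⊕ const (+ n) ⊛ (const (+ 1) ⊕ X)) ⊛ r) i j
  odd-insertionStep r linear n i j = begin
      insertionStep true n n r i j
    ≡⟨ cong (_+_ (δ 1 j * (r i 0 + xShift r i 1) + (+ n + + j + + i) * r i j))
            (shift-descending (+ n - + j) (λ k → r k j) i) ⟩
      δ 1 j * (r i 0 + xShift r i 1) + (+ n + + j + + i) * r i j + ((+ n - + j) * xShift r i j - xShift (θx r) i j)
    ≡⟨ rows j ⟩
      (θx r i j - xShift (θx r) i j) + (θz r i j - zShift (θz r) i j)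
        + (zShift r i j + + n * (r i j + xShift r i j))
    ≡⟨ cong₂ _+_ (cong₂ _+_ (x[1-x]∂x-coeff r i j) (z[1-z]∂z-coeff r i j)) (z+c[1+x]-coeff (+ n) r i j) ⟨
      (X ⊛ (const (+ 1) ⊖ X) ⊛ ∂x r
       ⊕ Z ⊛ (const (+ 1) ⊖ Z) ⊛ ∂z r
       ⊕ (Z ⊕ const (+ n) ⊛ (const (+ 1) ⊕ X)) ⊛ r) i j
    ∎
    where
    open ≡-Reasoning
    rows : ∀ j →
      δ 1 j * (r i 0 + xShift r i 1) + (+ n + + j + + i) * r i j + ((+ n - + j) * xShift r i j - xShift (θx r) i j)
      ≡ (θx r i j - xShift (θx r) i j) + (θz r i j - zShift (θz r) i j)
        + (zShift r i j + + n * (r i j + xShift r i j))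
    rows zero = row0 (+ n) (+ i) (r i 0) (xShift r i 0) (xShift (θx r) i 0)
      where
      row0 : ∀ N I a s t → + 0 + (N + + 0 + I) * a + ((N - + 0) * s - t)
                           ≡ (I * a - t) + (+ 0 * a - + 0) + (+ 0 + N * (a + s))
      row0 = solve-∀
    rows (suc zero) = row1 (+ n) (+ i) (r i 1) (r i 0) (xShift r i 1) (xShift (θx r) i 1)
      where
      row1 : ∀ N I a b s t → + 1 * (b + s) + (N + + 1 + I) * a + ((N - + 1) * s - t)
                             ≡ (I * a - t) + (+ 1 * a - + 0) + (b + N * (a + s))
      row1 = solve-∀
    rows (suc (suc l)) =
      high (+ n) (+ i) (+ suc (suc l)) (r i (suc (suc l))) (xShift r i (suc (suc l))) (xShift (θx r) i (suc (suc l)))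
           (linear i l) (xShift-high r linear i l) (xShift-θx-high r linear i l) (θz-positive r linear i l)
      where
      vanish : ∀ N I J c → + 0 + (N + J + I) * + 0 + ((N - J) * + 0 - + 0)
                           ≡ (I * + 0 - + 0) + (J * + 0 - c) + (c + N * (+ 0 + + 0))
      vanish = solve-∀
      high : ∀ N I J a s t {c d} → a ≡ + 0 → s ≡ + 0 → t ≡ + 0 → d ≡ c →
             + 0 + (N + J + I) * a + ((N - J) * s - t) ≡ (I * a - t) + (J * a - d) + (c + N * (a + s))
      high N I J _ _ _ {c} refl refl refl refl = vanish N I J c

  even-insertionStep : ∀ r → LinearInZ r → ∀ n i j →
    insertionStep false n (suc n) r i j
      ≡ (X ⊛ (const (+ 1) ⊖ X) ⊛ ∂x r
         ⊕ X ⊛ (const (+ 1) ⊖ Z) ⊛ ∂z r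
         ⊕ const (+ (1 ℕ.+ n)) ⊛ (const (+ 1) ⊕ X) ⊛ r) i j
  even-insertionStep r linear n i j = begin
      insertionStep false n (suc n) r i j
    ≡⟨ cong (_+_ (δ 0 j * (r i 0 + xShift r i 1) + (+ n + + j + + i) * r i j))
            (shift-descending (+ suc n - + j) (λ k → r k j) i) ⟩
      δ 0 j * (r i 0 + xShift r i 1) + (+ n + + j + + i) * r i j + ((+ suc n - + j) * xShift r i j - xShift (θx r) i j)
    ≡⟨ rows j ⟩
      (θx r i j - xShift (θx r) i j) + (+ suc j * xShift r i (suc j) - + j * xShift r i j)
        + + suc n * (r i j + xShift r i j)
    ≡⟨ cong₂ _+_ (cong₂ _+_ (x[1-x]∂x-coeff r i j) (x[1-z]∂z-coeff r i j)) (c[1+x]-coeff (+ suc n) r i j) ⟨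
      (X ⊛ (const (+ 1) ⊖ X) ⊛ ∂x r
       ⊕ X ⊛ (const (+ 1) ⊖ Z) ⊛ ∂z r
       ⊕ const (+ (1 ℕ.+ n)) ⊛ (const (+ 1) ⊕ X) ⊛ r) i j
    ∎
    where
    open ≡-Reasoning
    rows : ∀ j →
      δ 0 j * (r i 0 + xShift r i 1) + (+ n + + j + + i) * r i j + ((+ suc n - + j) * xShift r i j - xShift (θx r) i j)
      ≡ (θx r i j - xShift (θx r) i j) + (+ suc j * xShift r i (suc j) - + j * xShift r i j)
        + + suc n * (r i j + xShift r i j)
    rows zero = row0 (+ n) (+ i) (r i 0) (xShift r i 1) (xShift r i 0) (xShift (θx r) i 0)
      where
      row0 : ∀ N I a u s t → + 1 * (a + u) + (N + + 0 + I) * a + ((+ 1 + N - + 0) * s - t)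
                             ≡ (I * a - t) + (+ 1 * u - + 0 * s) + (+ 1 + N) * (a + s)
      row0 = solve-∀
    rows (suc zero) =
      row1 (+ n) (+ i) (r i 1) (xShift r i 1) (xShift (θx r) i 1) (xShift r i 2) (xShift-high r linear i 0)
      where
      vanish : ∀ N I a s t → + 0 + (N + + 1 + I) * a + ((+ 1 + N - + 1) * s - t)
                             ≡ (I * a - t) + (+ 2 * + 0 - + 1 * s) + (+ 1 + N) * (a + s)
      vanish = solve-∀
      row1 : ∀ N I a s t u → u ≡ + 0 →
             + 0 + (N + + 1 + I) * a + ((+ 1 + N - + 1) * s - t)
             ≡ (I * a - t) + (+ 2 * u - + 1 * s) + (+ 1 + N) * (a + s)
      row1 N I a s t _ refl = vanish N I a s t
    rows (suc (suc l)) =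
      high (+ n) (+ i) (+ suc (suc l)) (r i (suc (suc l))) (xShift r i (suc (suc l))) (xShift (θx r) i (suc (suc l)))
           (xShift r i (suc (suc (suc l))))
           (linear i l) (xShift-high r linear i l) (xShift-θx-high r linear i l) (xShift-high r linear i (suc l))
      where
      vanish : ∀ N I J → + 0 + (N + J + I) * + 0 + ((+ 1 + N - J) * + 0 - + 0)
                         ≡ (I * + 0 - + 0) + ((+ 1 + J) * + 0 - J * + 0) + (+ 1 + N) * (+ 0 + + 0)
      vanish = solve-∀
      high : ∀ N I J a s t u → a ≡ + 0 → s ≡ + 0 → t ≡ + 0 → u ≡ + 0 →
             + 0 + (N + J + I) * a + ((+ 1 + N - J) * s - t)
             ≡ (I * a - t) + ((+ 1 + J) * u - J * s) + (+ 1 + N) * (a + s)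
      high N I J _ _ _ _ refl refl refl refl = vanish N I J

open import Data.Nat using (_+_; _*_; _≥_)
open Insertion using (oddCount-oneTo)
open Counting using (insertionStep; Q-suc)
open Recurrences using (Q-linearInZ; odd-insertionStep; even-insertionStep)

isOdd-double : ∀ n → isOdd (n + n) ≡ false
isOdd-double zero    = refl
isOdd-double (suc n) = trans (cong (isOdd ∘ suc) (ℕ.+-suc n n)) (isOdd-double n)

isOdd-suc-double : ∀ n → isOdd (suc (n + n)) ≡ true
isOdd-suc-double zero    = refl
isOdd-suc-double (suc n) = trans (cong (isOdd ∘ suc ∘ suc) (ℕ.+-suc n n)) (isOdd-suc-double n)

Q-one : ∀ i j → Q 1 i j ≡ Z i j
Q-one zero    zero          = refl
Q-one zero    (suc zero)    = refl
Q-one zero    (suc (suc j)) = refl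
Q-one (suc i) zero          = refl
Q-one (suc i) (suc zero)    = refl
Q-one (suc i) (suc (suc j)) = refl

Q-two : ∀ i j → Q 2 i j ≡ (Z ⊕ X) i j
Q-two zero          zero          = refl
Q-two zero          (suc zero)    = refl
Q-two zero          (suc (suc j)) = refl
Q-two (suc zero)    zero          = refl
Q-two (suc zero)    (suc zero)    = refl
Q-two (suc zero)    (suc (suc j)) = refl
Q-two (suc (suc i)) zero          = refl
Q-two (suc (suc i)) (suc zero)    = refl
Q-two (suc (suc i)) (suc (suc j)) = refl

Q-odd : ∀ n {m} → m ≡ n + n → n ≥ 1 → ∀ i j →
  Q (m + 1) i j
    ≡ (X ⊛ (const (+ 1) ⊖ X) ⊛ ∂x (Q m)
       ⊕ Z ⊛ (const (+ 1) ⊖ Z) ⊛ ∂z (Q m)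
       ⊕ (Z ⊕ const (+ n) ⊛ (const (+ 1) ⊕ X)) ⊛ Q m) i j
Q-odd n refl n≥1 i j rewrite ℕ.+-comm (n + n) 1 = begin
    Q (suc (n + n)) i j
  ≡⟨ Q-suc (n + n) n n (ℕ.≤-trans n≥1 (ℕ.m≤m+n n n)) refl odd-letters i j ⟩
    insertionStep (isOdd (suc (n + n))) n n (Q (n + n)) i j
  ≡⟨ cong (λ b → insertionStep b n n (Q (n + n)) i j) (isOdd-suc-double n) ⟩
    insertionStep true n n (Q (n + n)) i j
  ≡⟨ odd-insertionStep (Q (n + n)) (Q-linearInZ (n + n)) n i j ⟩
    _ ∎
  where
  open ≡-Reasoning
  odd-letters = trans (oddCount-oneTo (n + n)) (sym (ℕ.n≡⌈n+n/2⌉ n))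

Q-even : ∀ n {m} → m ≡ n + n → ∀ i j →
  Q (m + 2) i j
    ≡ (X ⊛ (const (+ 1) ⊖ X) ⊛ ∂x (Q (m + 1))
       ⊕ X ⊛ (const (+ 1) ⊖ Z) ⊛ ∂z (Q (m + 1))
       ⊕ const (+ (1 + n)) ⊛ (const (+ 1) ⊕ X) ⊛ Q (m + 1)) i j
Q-even n refl i j rewrite ℕ.+-comm (n + n) 1 | ℕ.+-comm (n + n) 2 = begin
    Q (suc (suc (n + n))) i j
  ≡⟨ Q-suc (suc (n + n)) n (suc n) (s≤s z≤n) (ℕ.+-suc n n) odd-letters i j ⟩
    insertionStep (isOdd (suc (suc (n + n)))) n (suc n) (Q (suc (n + n))) i j
  ≡⟨ cong (λ b → insertionStep b n (suc n) (Q (suc (n + n))) i j) (isOdd-double n) ⟩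
    insertionStep false n (suc n) (Q (suc (n + n))) i j
  ≡⟨ even-insertionStep (Q (suc (n + n))) (Q-linearInZ (suc (n + n))) n i j ⟩
    _ ∎
  where
  open ≡-Reasoning
  odd-letters = trans (oddCount-oneTo (suc (n + n))) (cong suc (sym (ℕ.n≡⌊n+n/2⌋ n)))

corollary5p2 :
    (∀ i j → Q 1 i j ≡ Z i j)
    × (∀ i j → Q 2 i j ≡ (Z ⊕ X) i j)
    × (∀ (n : ℕ) → n ≥ 1 → ∀ i j →
        Q (2 * n + 1) i j
          ≡ (X ⊛ (const (+ 1) ⊖ X) ⊛ ∂x (Q (2 * n))
             ⊕ Z ⊛ (const (+ 1) ⊖ Z) ⊛ ∂z (Q (2 * n))
             ⊕ (Z ⊕ const (+ n) ⊛ (const (+ 1) ⊕ X)) ⊛ Q (2 * n)) i j)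
    × (∀ (n : ℕ) → n ≥ 1 → ∀ i j →
        Q (2 * n + 2) i j
          ≡ (X ⊛ (const (+ 1) ⊖ X) ⊛ ∂x (Q (2 * n + 1))
             ⊕ X ⊛ (const (+ 1) ⊖ Z) ⊛ ∂z (Q (2 * n + 1))
             ⊕ const (+ (1 + n)) ⊛ (const (+ 1) ⊕ X) ⊛ Q (2 * n + 1)) i j)
corollary5p2 = Q-one , Q-two , (λ n → Q-odd n (2n≡n+n n)) , (λ n _ → Q-even n (2n≡n+n n))
  where
  2n≡n+n : ∀ n → 2 * n ≡ n + n
  2n≡n+n n = cong (_+_ n) (ℕ.+-identityʳ n)
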